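{- Let $A$ be a finite algebra. If the enhanced power graph of $A$ is a cograph, then it is a chordal graph. Likewise, if the intersection power graph of $A$ is a cograph, then it is a chordal graph.
   Context: An algebra is a set $A$ with a collection of operations of various finite arities (nullary operations give constants). For $S\subseteq A$, $\langle S\rangle$ is the subalgebra generated by $S$; $\langle x\rangle=\langle\{x\}\rangle$. $E(A)=\langle\emptyset\rangle$ is the smallest subalgebra (possibly empty). Graphs are simple with vertex set $A$. Enhanced power graph: distinct $x,y$ adjacent iff there is $z\in A$ with $x,y\in\langle z\rangle$. Intersection power graph: distinct $x,y$ adjacent iff $x\in E(A)$ or $y\in E(A)$ or $\langle x\rangle\cap\langle y\rangle$ properly contains $E(A)$. A cograph is a graph with no induced subgraph isomorphic to the path on $4$ vertices. A chordal graph is a graph with no induced cycle of length greater than $3$. -}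

module Defs where

open import Data.Nat using (ℕ; zero; suc; _≤_)
open import Data.Fin using (Fin; toℕ)
open import Data.Product using (Σ; ∃; _×_; _,_)
open import Data.Sum using (_⊎_)
open import Relation.Nullary using (¬_)
open import Relation.Binary.PropositionalEquality using (_≡_; _≢_)
open import Function.Definitions using (Injective)

-- A finite algebra: carrier Fin size (any finite set, up to relabelling),
-- an arbitrary collection of operation symbols Op, each with a finite arity,
-- interpreted as functions (Fin arity → carrier) → carrier.
-- Nullary operations (arity 0) give constants.
record FiniteAlgebra : Set₁ where
  field
    size  : ℕ
    Op    : Set
    arity : Op → ℕ
    op    : (o : Op) → (Fin (arity o) → Fin size) → Fin size

  Carrier : Set
  Carrier = Fin size

  data ⟨_⟩∋_ (S : Carrier → Set) : Carrier → Set where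
    base : ∀ {x} → S x → ⟨ S ⟩∋ x
    app  : (o : Op) (xs : Fin (arity o) → Carrier) →
           (∀ k → ⟨ S ⟩∋ xs k) → ⟨ S ⟩∋ op o xs

  Gen1 : Carrier → Carrier → Set
  Gen1 x w = ⟨ (λ y → y ≡ x) ⟩∋ w

  E : Carrier → Set
  E w = ⟨ (λ _ → ⊥') ⟩∋ w
    where
    open import Data.Empty renaming (⊥ to ⊥')

  EnhancedAdj : Carrier → Carrier → Set
  EnhancedAdj x y = x ≢ y × ∃ λ z → Gen1 z x × Gen1 z y

  -- intersection power graph; since E(A) ⊆ ⟨x⟩ ∩ ⟨y⟩ always, "properly
  -- contains E(A)" means some element of ⟨x⟩ ∩ ⟨y⟩ lies outside E(A)
  IntersectionAdj : Carrier → Carrier → Set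
  IntersectionAdj x y =
    x ≢ y × (E x ⊎ E y ⊎ (∃ λ w → Gen1 x w × Gen1 y w × ¬ E w))

InducedCopy : {V : Set} (k : ℕ) (H : Fin k → Fin k → Set) (G : V → V → Set) → Set
InducedCopy {V} k H G =
  Σ (Fin k → V) λ f → Injective _≡_ _≡_ f ×
    (∀ i j → i ≢ j → (G (f i) (f j) → H i j) × (H i j → G (f i) (f j)))

PathAdj : (k : ℕ) → Fin k → Fin k → Set
PathAdj k i j = suc (toℕ i) ≡ toℕ j ⊎ suc (toℕ j) ≡ toℕ i

CycleAdj : (k : ℕ) → Fin k → Fin k → Set
CycleAdj k i j = PathAdj k i j
  ⊎ (toℕ i ≡ 0 × suc (toℕ j) ≡ k)
  ⊎ (toℕ j ≡ 0 × suc (toℕ i) ≡ k)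

IsCograph : {V : Set} → (V → V → Set) → Set
IsCograph G = ¬ InducedCopy 4 (PathAdj 4) G

IsChordal : {V : Set} → (V → V → Set) → Set
IsChordal G = ∀ k → 4 ≤ k → ¬ InducedCopy k (CycleAdj k) G

module Submission where

open import Defs
open import Data.Empty using (⊥-elim)
open import Data.Fin using (Fin)
open import Data.Fin.Patterns using (0F; 1F; 2F; 3F)
open import Data.Nat using (_≤_; s≤s)
open import Data.Product using (_×_; _,_; proj₁; proj₂)
open import Data.Sum using (inj₁; inj₂)
open import Function using (_∘_; const)
open import Relation.Binary.Definitions using (Symmetric)
open import Relation.Nullary using (¬_; contradiction)
open import Relation.Binary.PropositionalEquality using (_≡_; _≢_; refl; sym; subst)

-- If x ∈ ⟨z⟩ (enhanced power graph) or z ∈ ⟨x⟩ \ E(A) (intersection power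
-- graph), every neighbour of z is a neighbour of x. An edge a — b therefore has
-- a witness z whose neighbourhood lies in N[a] ∩ N[b]. In an induced cycle
-- a — b — c — d — ⋯ of length ≥ 4, replacing a by such a z for the edge a — b
-- keeps z — b while z is adjacent to neither c nor d, so z — b — c — d is an
-- induced P4.

module _ {V : Set} (G : V → V → Set) where

  Dominates : V → V → Set
  Dominates x z = ∀ {u} → G z u → u ≢ x → G x u

  record EdgeDominator (x y : V) : Set where
    constructor edgeDominator
    field
      vertex         : V
      adjacent       : vertex ≢ y → G vertex y
      dominated-by-x : Dominates x vertex
      dominated-by-y : Dominates y vertex

  HasEdgeDominators : Set
  HasEdgeDominators = ∀ {x y} → G x y → EdgeDominator x y

  record InducedP4orC4 : Set where
    field
      a b c d : V
      a≢c : a ≢ c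
      b≢c : b ≢ c
      b≢d : b ≢ d
      c≢d : c ≢ d
      ab : G a b
      bc : G b c
      cd : G c d
      a≁c : ¬ G a c
      b≁d : ¬ G b d

  dominates-refl : ∀ {x} → Dominates x x
  dominates-refl xu _ = xu

  universal-dominates : ∀ {x z} → (∀ {u} → u ≢ x → G x u) → Dominates x z
  universal-dominates universal _ = universal

  cycle⇒InducedP4orC4 : ∀ {k} → 4 ≤ k → InducedCopy k (CycleAdj k) G → InducedP4orC4
  cycle⇒InducedP4orC4 (s≤s (s≤s (s≤s (s≤s _)))) (f , f-injective , f-induced) = record
    { a = f 0F ; b = f 1F ; c = f 2F ; d = f 3F
    ; a≢c = distinct (λ ()) ; b≢c = distinct (λ ()) ; b≢d = distinct (λ ()) ; c≢d = distinct (λ ())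
    ; ab = edge (λ ()) (inj₁ (inj₁ refl))
    ; bc = edge (λ ()) (inj₁ (inj₁ refl))
    ; cd = edge (λ ()) (inj₁ (inj₁ refl))
    ; a≁c = nonEdge (λ ()) λ { (inj₁ (inj₁ ())) ; (inj₁ (inj₂ ())) ; (inj₂ (inj₁ (_ , ()))) ; (inj₂ (inj₂ (() , _))) }
    ; b≁d = nonEdge (λ ()) λ { (inj₁ (inj₁ ())) ; (inj₁ (inj₂ ())) ; (inj₂ (inj₁ (() , _))) ; (inj₂ (inj₂ (() , _))) }
    }
    where
    distinct : ∀ {i j} → i ≢ j → f i ≢ f j
    distinct i≢j = i≢j ∘ f-injective
    edge : ∀ {i j} → i ≢ j → CycleAdj _ i j → G (f i) (f j)
    edge i≢j = proj₂ (f-induced _ _ i≢j)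
    nonEdge : ∀ {i j} → i ≢ j → ¬ CycleAdj _ i j → ¬ G (f i) (f j)
    nonEdge i≢j ¬ij = ¬ij ∘ proj₁ (f-induced _ _ i≢j)

module _ {V : Set} {G : V → V → Set} (G-sym : Symmetric G) where

  inducedP4 : (a b c d : V) → a ≢ b → a ≢ c → a ≢ d → b ≢ c → b ≢ d → c ≢ d →
              G a b → G b c → G c d → ¬ G a c → ¬ G a d → ¬ G b d →
              InducedCopy 4 (PathAdj 4) G
  inducedP4 a b c d a≢b a≢c a≢d b≢c b≢d c≢d ab bc cd a≁c a≁d b≁d = f , injective , induced
    where
    f : Fin 4 → V
    f 0F = a
    f 1F = b
    f 2F = c
    f 3F = d

    injective : ∀ {i j} → f i ≡ f j → i ≡ j
    injective {0F} {0F} _ = refl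
    injective {0F} {1F} e = contradiction e a≢b
    injective {0F} {2F} e = contradiction e a≢c
    injective {0F} {3F} e = contradiction e a≢d
    injective {1F} {0F} e = contradiction (sym e) a≢b
    injective {1F} {1F} _ = refl
    injective {1F} {2F} e = contradiction e b≢c
    injective {1F} {3F} e = contradiction e b≢d
    injective {2F} {0F} e = contradiction (sym e) a≢c
    injective {2F} {1F} e = contradiction (sym e) b≢c
    injective {2F} {2F} _ = refl
    injective {2F} {3F} e = contradiction e c≢d
    injective {3F} {0F} e = contradiction (sym e) a≢d
    injective {3F} {1F} e = contradiction (sym e) b≢d
    injective {3F} {2F} e = contradiction (sym e) c≢d
    injective {3F} {3F} _ = refl

    Agrees : Fin 4 → Fin 4 → Set
    Agrees i j = (G (f i) (f j) → PathAdj 4 i j) × (PathAdj 4 i j → G (f i) (f j))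

    edge : ∀ {i j} → PathAdj 4 i j → G (f i) (f j) → Agrees i j
    edge p e = const p , const e

    nonEdge : ∀ {i j} → ¬ PathAdj 4 i j → ¬ G (f i) (f j) → Agrees i j
    nonEdge ¬p ¬e = ⊥-elim ∘ ¬e , ⊥-elim ∘ ¬p


    induced : ∀ i j → i ≢ j → Agrees i j
    induced 0F 0F i≢i = contradiction refl i≢i
    induced 0F 1F _ = edge (inj₁ refl) ab
    induced 0F 2F _ = nonEdge (λ { (inj₁ ()) ; (inj₂ ()) }) a≁c
    induced 0F 3F _ = nonEdge (λ { (inj₁ ()) ; (inj₂ ()) }) a≁d
    induced 1F 0F _ = edge (inj₂ refl) (G-sym ab)
    induced 1F 1F i≢i = contradiction refl i≢i
    induced 1F 2F _ = edge (inj₁ refl) bc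
    induced 1F 3F _ = nonEdge (λ { (inj₁ ()) ; (inj₂ ()) }) b≁d
    induced 2F 0F _ = nonEdge (λ { (inj₁ ()) ; (inj₂ ()) }) (a≁c ∘ G-sym)
    induced 2F 1F _ = edge (inj₂ refl) (G-sym bc)
    induced 2F 2F i≢i = contradiction refl i≢i
    induced 2F 3F _ = edge (inj₁ refl) cd
    induced 3F 0F _ = nonEdge (λ { (inj₁ ()) ; (inj₂ ()) }) (a≁d ∘ G-sym)
    induced 3F 1F _ = nonEdge (λ { (inj₁ ()) ; (inj₂ ()) }) (b≁d ∘ G-sym)
    induced 3F 2F _ = edge (inj₂ refl) (G-sym cd)
    induced 3F 3F i≢i = contradiction refl i≢i

  module _ (dominators : HasEdgeDominators G) where

    InducedP4orC4⇒inducedP4 : InducedP4orC4 G → InducedCopy 4 (PathAdj 4) G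
    InducedP4orC4⇒inducedP4 q =
      inducedP4 z b c d z≢b z≢c z≢d b≢c b≢d c≢d (adjacent z≢b) bc cd z≁c z≁d b≁d
      where
      open InducedP4orC4 q
      open EdgeDominator (dominators ab) renaming (vertex to z)
      z≁c : ¬ G z c
      z≁c zc = a≁c (dominated-by-x zc (a≢c ∘ sym))
      z≁d : ¬ G z d
      z≁d zd = b≁d (dominated-by-y zd (b≢d ∘ sym))
      z≢b : z ≢ b
      z≢b z≡b = z≁c (subst (λ v → G v c) (sym z≡b) bc)
      z≢c : z ≢ c
      z≢c z≡c = z≁d (subst (λ v → G v d) (sym z≡c) cd)
      z≢d : z ≢ d
      z≢d z≡d = z≁c (subst (λ v → G v c) (sym z≡d) (G-sym cd))

    cograph⇒chordal : IsCograph G → IsChordal G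
    cograph⇒chordal noP4 _ 4≤k = noP4 ∘ InducedP4orC4⇒inducedP4 ∘ cycle⇒InducedP4orC4 G 4≤k

module _ (A : FiniteAlgebra) where
  open FiniteAlgebra A

  Gen1-refl : ∀ {x} → Gen1 x x
  Gen1-refl = base refl

  Gen1-trans : ∀ {x y w} → Gen1 x y → Gen1 y w → Gen1 x w
  Gen1-trans x∋y (base refl)      = x∋y
  Gen1-trans x∋y (app o xs y∋xs) = app o xs (λ k → Gen1-trans x∋y (y∋xs k))

  EnhancedAdj-sym : Symmetric EnhancedAdj
  EnhancedAdj-sym (x≢y , z , z∋x , z∋y) = x≢y ∘ sym , z , z∋y , z∋x

  EnhancedAdj-dominates : ∀ {x z} → Gen1 z x → Dominates EnhancedAdj x z
  EnhancedAdj-dominates z∋x (_ , w , w∋z , w∋u) u≢x = u≢x ∘ sym , w , Gen1-trans w∋z z∋x , w∋u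

  EnhancedAdj-edgeDominators : HasEdgeDominators EnhancedAdj
  EnhancedAdj-edgeDominators (_ , z , z∋x , z∋y) = edgeDominator z
    (λ z≢y → z≢y , z , Gen1-refl , z∋y)
    (EnhancedAdj-dominates z∋x)
    (EnhancedAdj-dominates z∋y)

  IntersectionAdj-sym : Symmetric IntersectionAdj
  IntersectionAdj-sym (x≢y , inj₁ Ex)        = x≢y ∘ sym , inj₂ (inj₁ Ex)
  IntersectionAdj-sym (x≢y , inj₂ (inj₁ Ey)) = x≢y ∘ sym , inj₁ Ey
  IntersectionAdj-sym (x≢y , inj₂ (inj₂ (w , x∋w , y∋w , w∉E))) = x≢y ∘ sym , inj₂ (inj₂ (w , y∋w , x∋w , w∉E))

  IntersectionAdj-universal : ∀ {x u} → E x → u ≢ x → IntersectionAdj x u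
  IntersectionAdj-universal Ex u≢x = u≢x ∘ sym , inj₁ Ex

  IntersectionAdj-dominates : ∀ {x z} → Gen1 x z → ¬ E z → Dominates IntersectionAdj x z
  IntersectionAdj-dominates _ z∉E (_ , inj₁ Ez) _ = contradiction Ez z∉E
  IntersectionAdj-dominates _ _ (_ , inj₂ (inj₁ Eu)) u≢x = u≢x ∘ sym , inj₂ (inj₁ Eu)
  IntersectionAdj-dominates x∋z z∉E (_ , inj₂ (inj₂ (w , z∋w , u∋w , w∉E))) u≢x =
    u≢x ∘ sym , inj₂ (inj₂ (w , Gen1-trans x∋z z∋w , u∋w , w∉E))

  -- An endpoint in E(A) is universal, so the other endpoint is a dominator.
  IntersectionAdj-edgeDominators : HasEdgeDominators IntersectionAdj
  IntersectionAdj-edgeDominators {y = y} (_ , inj₁ Ex) = edgeDominator y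
    (λ y≢y → contradiction refl y≢y)
    (universal-dominates IntersectionAdj (IntersectionAdj-universal Ex))
    (dominates-refl IntersectionAdj)
  IntersectionAdj-edgeDominators {x = x} xy@(_ , inj₂ (inj₁ Ey)) = edgeDominator x
    (const xy)
    (dominates-refl IntersectionAdj)
    (universal-dominates IntersectionAdj (IntersectionAdj-universal Ey))
  IntersectionAdj-edgeDominators (_ , inj₂ (inj₂ (w , x∋w , y∋w , w∉E))) = edgeDominator w
    (λ w≢y → w≢y , inj₂ (inj₂ (w , Gen1-refl , y∋w , w∉E)))
    (IntersectionAdj-dominates x∋w w∉E)
    (IntersectionAdj-dominates y∋w w∉E)

mainTheorem5 : (A : FiniteAlgebra) →
    (IsCograph (FiniteAlgebra.EnhancedAdj A) → IsChordal (FiniteAlgebra.EnhancedAdj A)) ×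
    (IsCograph (FiniteAlgebra.IntersectionAdj A) → IsChordal (FiniteAlgebra.IntersectionAdj A))
mainTheorem5 A =
  cograph⇒chordal (EnhancedAdj-sym A) (EnhancedAdj-edgeDominators A) ,
  cograph⇒chordal (IntersectionAdj-sym A) (IntersectionAdj-edgeDominators A)
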